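{- For all sufficiently large $k$ the following holds. Let $\sigma\in[k]^n$ with $n<(1+e^{ -600})k^2/e$, let $a_m$ denote the number of occurrences of symbol $m$ in $\sigma$, and suppose at least $0.99k$ symbols are common (i.e.\ satisfy $a_m>0.1k$). Then there are at least $0.03k$ common symbols $m$ for which the number of full $m$-gaps is less than $0.9a_m$.
   Context: $[k]=\{1,\dots,k\}$; its elements are called symbols. If symbol $m$ occurs in $\sigma$ exactly at positions $s_1<\dots<s_{a_m}$, an $m$-gap is the (possibly empty) set of positions strictly between $s_j$ and $s_{j+1}$, for some $1\le j<a_m$. An $m$-gap is full if there exists a symbol $m'\ne m$ such that the gap contains at least $0.9a_{m'}$ occurrences of $m'$. -}

module Defs where

open import Data.Nat using (ℕ; zero; suc; _+_; _*_; _^_; _<_; _≤_)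
open import Data.Nat.Properties using (_<?_; _≤?_)
open import Data.Fin using (Fin; toℕ)
open import Data.Fin.Properties using () renaming (_≟_ to _≟ᶠ_)
open import Data.Bool using (Bool; true; false; _∧_; not; T?)
open import Data.List using (List; length; filter; allFin; concatMap; map)
open import Data.Bool.ListAction using (any)
open import Data.Product using (∃; _×_; _,_)
open import Relation.Nullary using (does)

Seq : ℕ → ℕ → Set
Seq k n = Fin n → Fin k

countB : {A : Set} → (A → Bool) → List A → ℕ
countB p xs = length (filter (λ x → T? (p x)) xs)

occ : ∀ {k n} → Seq k n → Fin k → ℕ
occ {n = n} σ m = countB (λ i → does (σ i ≟ᶠ m)) (allFin n)

occBetween : ∀ {k n} → Seq k n → Fin k → Fin n → Fin n → ℕ
occBetween {n = n} σ m' p q =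
  countB (λ i → does (σ i ≟ᶠ m') ∧ does (toℕ p <? toℕ i) ∧ does (toℕ i <? toℕ q))
         (allFin n)

isGapB : ∀ {k n} → Seq k n → Fin k → Fin n → Fin n → Bool
isGapB σ m p q =
  does (σ p ≟ᶠ m) ∧ does (σ q ≟ᶠ m) ∧ does (toℕ p <? toℕ q)
  ∧ does (occBetween σ m p q Data.Nat.≟ 0)
  where import Data.Nat

-- the gap between p and q is full: some symbol m' ≠ m occurring in σ has
-- at least 0.9 a_{m'} occurrences inside the gap  (10·count ≥ 9·a_{m'}).
-- (m' is required to occur in σ)
isFullB : ∀ {k n} → Seq k n → Fin k → Fin n → Fin n → Bool
isFullB {k = k} σ m p q =
  any (λ m' → not (does (m' ≟ᶠ m))
              ∧ does (1 ≤? occ σ m')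
              ∧ does (9 * occ σ m' ≤? 10 * occBetween σ m' p q))
      (allFin k)

fullGaps : ∀ {k n} → Seq k n → Fin k → ℕ
fullGaps {n = n} σ m =
  countB (λ pq → isGapB σ m (Data.Product.proj₁ pq) (Data.Product.proj₂ pq)
                 ∧ isFullB σ m (Data.Product.proj₁ pq) (Data.Product.proj₂ pq))
         (concatMap (λ p → map (λ q → (p , q)) (allFin n)) (allFin n))
  where import Data.Product

isCommonB : ∀ {k n} → Seq k n → Fin k → Bool
isCommonB {k = k} σ m = does (k <? 10 * occ σ m)

numCommon : ∀ {k n} → Seq k n → ℕ
numCommon {k = k} σ = countB (isCommonB σ) (allFin k)

numGood : ∀ {k n} → Seq k n → ℕ
numGood {k = k} σ =
  countB (λ m → isCommonB σ m ∧ does (10 * fullGaps σ m <? 9 * occ σ m)) (allFin k)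

-- n < (1 + e^{-600}) k² / e  =  (e^{-1} + e^{-601}) k².
-- With r_N = (N/(N+1))^{N+1}, which increases strictly to e^{-1},
-- L_N = r_N + r_N^{601} increases strictly to c = e^{-1} + e^{-601}; hence
-- n < c k²  ⇔  ∃ N. n < L_N k², i.e. in ℕ:
--   n · (N+1)^{601(N+1)} < k² · (N^{N+1} (N+1)^{600(N+1)} + N^{601(N+1)}).
BelowBound : ℕ → ℕ → Set
BelowBound n k = ∃ λ N →
  n * (suc N ^ (601 * suc N))
    < (k * k) * (N ^ suc N * suc N ^ (600 * suc N) + N ^ (601 * suc N))

module Submission where

-- Call a symbol bad if it is common and has at least 0.9 a_m full m-gaps. If fewer than 0.03k
-- symbols were good, the 0.99k common ones would make more than 0.96k symbols bad. A full m-gap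
-- contains 90% of the occurrences of some witness symbol w, so distinct (hence disjoint) m-gaps
-- have distinct witnesses, and among the full m-gaps of any window all but at most #(non-bad
-- symbols) < 0.04k have a bad witness w. Each full w-gap not inside such an m-gap has an
-- endpoint among the at most 0.1 a_w occurrences of w outside it, so the m-gap strictly
-- contains at least 0.8 a_w > 0.08k full w-gaps. Starting from the whole sequence and any bad
-- symbol, this gives an infinite descent of strictly shrinking windows.

open import Defs
open import Data.Bool using (Bool; true; false; T; T?; _∧_; not)
open import Data.Bool.ListAction using (any)
open import Data.Empty using (⊥; ⊥-elim)
open import Data.Fin using (Fin; toℕ)
open import Data.Fin.Properties using (toℕ-injective; toℕ<n) renaming (_≟_ to _≟ᶠ_)
open import Data.List
  using (List; []; _∷_; _++_; length; filter; map; concatMap; allFin; cartesianProduct)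
open import Data.List.Properties using (filter-some; length-tabulate)
open import Data.List.Membership.Propositional using (_∈_; lose)
open import Data.List.Membership.Propositional.Properties using (∈-∃++; ∈-filter⁻; ∈-allFin)
open import Data.List.Relation.Unary.All using (lookup)
open import Data.List.Relation.Unary.AllPairs using ([]; _∷_)
open import Data.List.Relation.Unary.Any using (here; there; satisfied)
open import Data.List.Relation.Unary.Any.Properties using (any⁺; any⁻)
open import Data.List.Relation.Unary.Unique.Propositional using (Unique)
open import Data.List.Relation.Unary.Unique.Propositional.Properties
  using (allFin⁺; cartesianProduct⁺)
open import Data.Nat
  using (ℕ; zero; suc; _+_; _*_; _<_; _≤_; _≟_; z≤n; s≤s; z<s; >-nonZero)
open import Data.Nat.Properties
open import Data.Product using (∃; _×_; _,_; proj₁; proj₂)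
open import Relation.Binary.Definitions using (tri<; tri≈; tri>)
open import Relation.Binary.PropositionalEquality
open import Relation.Nullary using (¬_; Dec; yes; no; does)
open import Relation.Nullary.Decidable using (_×-dec_; ¬?; decidable-stable)

-- Composite deciders built with _×-dec_ and ¬? have exactly the _∧_/not shape of the boolean
-- tests in Defs, so these two functions read those tests as propositions.
from-does : {P : Set} (d : Dec P) → T (does d) → P
from-does (yes p) _ = p

to-does : {P : Set} (d : Dec P) → P → T (does d)
to-does (yes _) _  = _
to-does (no ¬p) p = ¬p p

module _ {A : Set} where

  countB-split : (p c : A → Bool) (xs : List A) →
    countB p xs ≡ countB (λ x → p x ∧ c x) xs + countB (λ x → p x ∧ not (c x)) xs
  countB-split p c [] = refl
  countB-split p c (x ∷ xs) with p x | c x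
  ... | true  | true  = cong suc (countB-split p c xs)
  ... | true  | false = trans (cong suc (countB-split p c xs)) (sym (+-suc _ _))
  ... | false | _     = countB-split p c xs

  countB-complement : (c : A → Bool) (xs : List A) →
    countB c xs + countB (λ x → not (c x)) xs ≡ length xs
  countB-complement c [] = refl
  countB-complement c (x ∷ xs) with c x
  ... | true  = cong suc (countB-complement c xs)
  ... | false = trans (+-suc _ _) (cong suc (countB-complement c xs))

  countB-mono : {p q : A → Bool} → (∀ x → T (p x) → T (q x)) → (xs : List A) →
    countB p xs ≤ countB q xs
  countB-mono p⇒q [] = z≤n
  countB-mono {p} {q} p⇒q (x ∷ xs) with p x in px | q x in qx
  ... | true  | true  = s≤s (countB-mono p⇒q xs)
  ... | true  | false = ⊥-elim (subst T qx (p⇒q x (subst T (sym px) _)))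
  ... | false | true  = m≤n⇒m≤1+n (countB-mono p⇒q xs)
  ... | false | false = countB-mono p⇒q xs

  countB-pos : (p : A → Bool) {x : A} {xs : List A} → x ∈ xs → T (p x) → 0 < countB p xs
  countB-pos p x∈xs px = filter-some (λ x → T? (p x)) (lose x∈xs px)

  countB-witness : (p : A → Bool) (xs : List A) → 0 < countB p xs → ∃ λ x → T (p x)
  countB-witness p xs pos with filter (λ x → T? (p x)) xs in eq
  ... | x ∷ _ =
    x , proj₂ (∈-filter⁻ (λ x → T? (p x)) {xs = xs} (subst (x ∈_) (sym eq) (here refl)))

  countB-remove : (q : A → Bool) {y : A} → T (q y) → ∀ us {vs} →
    countB q (us ++ y ∷ vs) ≡ suc (countB q (us ++ vs))
  countB-remove q {y} qy [] with q y
  ... | true = refl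
  countB-remove q qy (u ∷ us) with q u
  ... | true  = cong suc (countB-remove q qy us)
  ... | false = countB-remove q qy us

  ∈-remove : {z w : A} (us : List A) {vs : List A} → z ∈ us ++ w ∷ vs → z ≢ w → z ∈ us ++ vs
  ∈-remove []       (here z≡w) z≢w = ⊥-elim (z≢w z≡w)
  ∈-remove []       (there z∈) _   = z∈
  ∈-remove (u ∷ us) (here z≡u) _   = here z≡u
  ∈-remove (u ∷ us) (there z∈) z≢w = there (∈-remove us z∈ z≢w)

countB-injection : {A B : Set} {p : A → Bool} {q : B → Bool} (f : ∀ x → T (p x) → B) →
  (∀ x y px py → f x px ≡ f y py → x ≡ y) →
  ∀ {xs} → Unique xs → ∀ ys →
  (∀ {x} → x ∈ xs → (px : T (p x)) → f x px ∈ ys × T (q (f x px))) →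
  countB p xs ≤ countB q ys
countB-injection f inj [] ys maps = z≤n
countB-injection {p = p} {q} f inj {x ∷ xs} (x∉xs ∷ uniq) ys maps with p x in px
... | false = countB-injection f inj uniq ys (λ y∈ → maps (there y∈))
... | true  with ∈-∃++ (proj₁ (maps (here refl) (subst T (sym px) _)))
... | us , vs , refl = begin
  suc (countB p xs)            ≤⟨ s≤s (countB-injection f inj uniq (us ++ vs) maps′) ⟩
  suc (countB q (us ++ vs))    ≡⟨ countB-remove q (proj₂ (maps (here refl) fx)) us ⟨
  countB q (us ++ f x fx ∷ vs) ∎
  where
    open ≤-Reasoning
    fx : T (p x)
    fx = subst T (sym px) _
    maps′ : ∀ {y} → y ∈ xs → (py : T (p y)) → f y py ∈ us ++ vs × T (q (f y py))
    maps′ y∈ py =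
      ∈-remove us (proj₁ (maps (there y∈) py)) (λ fy≡fx → lookup x∉xs y∈ (sym (inj _ _ py fx fy≡fx)))
      , proj₂ (maps (there y∈) py)

pairs≡cartesianProduct : {A B : Set} (xs : List A) (ys : List B) →
  concatMap (λ x → map (x ,_) ys) xs ≡ cartesianProduct xs ys
pairs≡cartesianProduct []       ys = refl
pairs≡cartesianProduct (x ∷ xs) ys = cong (map (x ,_) ys ++_) (pairs≡cartesianProduct xs ys)

positionPairs : (n : ℕ) → List (Fin n × Fin n)
positionPairs n = concatMap (λ p → map (p ,_) (allFin n)) (allFin n)

positionPairs-unique : (n : ℕ) → Unique (positionPairs n)
positionPairs-unique n = subst Unique (sym (pairs≡cartesianProduct (allFin n) (allFin n)))
  (cartesianProduct⁺ (allFin⁺ n) (allFin⁺ n))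

disjoint-majorities : ∀ {a x y} → 0 < a → 9 * a ≤ 10 * x → 9 * a ≤ 10 * y → x + y ≤ a → ⊥
disjoint-majorities {a} {x} {y} 0<a 9a≤10x 9a≤10y x+y≤a = <-irrefl refl (begin-strict
  10 * a          <⟨ *-monoˡ-< a {{>-nonZero 0<a}} {10} {18} (m<m+n 10 z<s) ⟩
  18 * a          ≡⟨ *-distribʳ-+ a 9 9 ⟩
  9 * a + 9 * a   ≤⟨ +-mono-≤ 9a≤10x 9a≤10y ⟩
  10 * x + 10 * y ≡⟨ *-distribˡ-+ 10 x y ⟨
  10 * (x + y)    ≤⟨ *-monoʳ-≤ 10 x+y≤a ⟩
  10 * a          ∎)
  where open ≤-Reasoning

nested-majority : ∀ {a O Z F X k N} → a ≡ O + Z → 9 * a ≤ 10 * O → 9 * a ≤ 10 * F → F ≤ X + Z →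
  k < 10 * a → 100 * N < 4 * k → N < X
nested-majority {a} {O} {Z} {F} {X} {k} {N} a≡O+Z 9a≤10O 9a≤10F F≤X+Z k<10a 100N<4k =
  *-cancelˡ-< 100 N X (begin-strict
    100 * N      <⟨ 100N<4k ⟩
    4 * k        <⟨ *-monoʳ-< 4 k<10a ⟩
    4 * (10 * a) ≡⟨ trans (sym (*-assoc 4 10 a)) (*-assoc 5 8 a) ⟩
    5 * (8 * a)  ≤⟨ *-monoʳ-≤ 5 8a≤10X ⟩
    5 * (10 * X) ≡⟨ *-assoc 5 10 X ⟨
    50 * X       ≤⟨ *-monoˡ-≤ X (m≤m+n 50 50) ⟩
    100 * X      ∎)
  where
    open ≤-Reasoning
    9Z≤O : 9 * Z ≤ O
    9Z≤O = +-cancelˡ-≤ (9 * O) _ _ (begin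
      9 * O + 9 * Z ≡⟨ *-distribˡ-+ 9 O Z ⟨
      9 * (O + Z)   ≡⟨ cong (9 *_) a≡O+Z ⟨
      9 * a         ≤⟨ 9a≤10O ⟩
      O + 9 * O     ≡⟨ +-comm O (9 * O) ⟩
      9 * O + O     ∎)
    10Z≤a : 10 * Z ≤ a
    10Z≤a = begin
      Z + 9 * Z ≡⟨ +-comm Z (9 * Z) ⟩
      9 * Z + Z ≤⟨ +-monoˡ-≤ Z 9Z≤O ⟩
      O + Z     ≡⟨ a≡O+Z ⟨
      a         ∎
    8a≤10X : 8 * a ≤ 10 * X
    8a≤10X = +-cancelʳ-≤ a (8 * a) (10 * X) (begin
      8 * a + a       ≡⟨ +-comm (8 * a) a ⟩
      9 * a           ≤⟨ 9a≤10F ⟩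
      10 * F          ≤⟨ *-monoʳ-≤ 10 F≤X+Z ⟩
      10 * (X + Z)    ≡⟨ *-distribˡ-+ 10 X Z ⟩
      10 * X + 10 * Z ≤⟨ +-monoʳ-≤ (10 * X) 10Z≤a ⟩
      10 * X + a      ∎)

bad-supermajority : ∀ {k C G B} → C ≡ G + B → 99 * k ≤ 100 * C → 100 * G < 3 * k → 96 * k < 100 * B
bad-supermajority {k} {C} {G} {B} C≡G+B 99k≤100C 100G<3k =
  +-cancelˡ-< (3 * k) (96 * k) (100 * B) (begin-strict
  3 * k + 96 * k    ≡⟨ *-distribʳ-+ k 3 96 ⟨
  99 * k            ≤⟨ 99k≤100C ⟩
  100 * C           ≡⟨ trans (cong (100 *_) C≡G+B) (*-distribˡ-+ 100 G B) ⟩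
  100 * G + 100 * B <⟨ +-monoˡ-< (100 * B) 100G<3k ⟩
  3 * k + 100 * B   ∎)
  where open ≤-Reasoning

few-not-bad : ∀ {k B N} → k ≡ B + N → 96 * k < 100 * B → 100 * N < 4 * k
few-not-bad {k} {B} {N} k≡B+N 96k<100B =
  +-cancelˡ-< (96 * k) (100 * N) (4 * k) (begin-strict
  96 * k + 100 * N  <⟨ +-monoˡ-< (100 * N) 96k<100B ⟩
  100 * B + 100 * N ≡⟨ *-distribˡ-+ 100 B N ⟨
  100 * (B + N)     ≡⟨ cong (100 *_) k≡B+N ⟨
  100 * k           ≡⟨ *-distribʳ-+ k 96 4 ⟩
  96 * k + 4 * k    ∎)
  where open ≤-Reasoning

positive-summand : ∀ {a b c} → c < a + b → b ≤ c → 0 < a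
positive-summand {zero}  c<b b≤c = ⊥-elim (<⇒≱ c<b b≤c)
positive-summand {suc a} _   _   = z<s

module _ {k n : ℕ} (σ : Seq k n) where

  record IsGap (m : Fin k) (p q : Fin n) : Set where
    field
      start       : σ p ≡ m
      end         : σ q ≡ m
      start<end   : toℕ p < toℕ q
      no-m-inside : ∀ i → toℕ p < toℕ i → toℕ i < toℕ q → σ i ≢ m

  open IsGap

  isGap⇒ : ∀ m p q → T (isGapB σ m p q) → IsGap m p q
  isGap⇒ m p q t with from-does
    ((σ p ≟ᶠ m) ×-dec (σ q ≟ᶠ m) ×-dec (toℕ p <? toℕ q) ×-dec (occBetween σ m p q ≟ 0)) t
  ... | σp≡m , σq≡m , p<q , none-between = record
    { start = σp≡m ; end = σq≡m ; start<end = p<q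
    ; no-m-inside = λ i p<i i<q σi≡m → m<n⇒n≢0 (countB-pos _ (∈-allFin i)
        (to-does ((σ i ≟ᶠ m) ×-dec (toℕ p <? toℕ i) ×-dec (toℕ i <? toℕ q)) (σi≡m , p<i , i<q)))
        none-between
    }

  overlapping-gaps-coincide : ∀ {m p₁ q₁ p₂ q₂} → IsGap m p₁ q₁ → IsGap m p₂ q₂ →
    toℕ p₁ < toℕ q₂ → toℕ p₂ < toℕ q₁ → (p₁ , q₁) ≡ (p₂ , q₂)
  overlapping-gaps-coincide {p₁ = p₁} {q₁} {p₂} {q₂} g₁ g₂ p₁<q₂ p₂<q₁ =
    cong₂ _,_ (toℕ-injective same-start) (toℕ-injective same-end)
    where
      same-start : toℕ p₁ ≡ toℕ p₂
      same-start with <-cmp (toℕ p₁) (toℕ p₂)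
      ... | tri< p₁<p₂ _ _ = ⊥-elim (no-m-inside g₁ p₂ p₁<p₂ p₂<q₁ (start g₂))
      ... | tri≈ _ p₁≡p₂ _ = p₁≡p₂
      ... | tri> _ _ p₂<p₁ = ⊥-elim (no-m-inside g₂ p₁ p₂<p₁ p₁<q₂ (start g₁))
      same-end : toℕ q₁ ≡ toℕ q₂
      same-end with <-cmp (toℕ q₁) (toℕ q₂)
      ... | tri< q₁<q₂ _ _ = ⊥-elim (no-m-inside g₂ q₁ p₂<q₁ q₁<q₂ (end g₁))
      ... | tri≈ _ q₁≡q₂ _ = q₁≡q₂
      ... | tri> _ _ q₂<q₁ = ⊥-elim (no-m-inside g₁ q₂ p₁<q₂ q₂<q₁ (end g₂))

  gaps-with-same-start-coincide : ∀ {m p₁ q₁ p₂ q₂} → IsGap m p₁ q₁ → IsGap m p₂ q₂ →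
    p₁ ≡ p₂ → (p₁ , q₁) ≡ (p₂ , q₂)
  gaps-with-same-start-coincide g₁ g₂ refl =
    overlapping-gaps-coincide g₁ g₂ (start<end g₂) (start<end g₁)

  gaps-with-same-end-coincide : ∀ {m p₁ q₁ p₂ q₂} → IsGap m p₁ q₁ → IsGap m p₂ q₂ →
    q₁ ≡ q₂ → (p₁ , q₁) ≡ (p₂ , q₂)
  gaps-with-same-end-coincide g₁ g₂ refl =
    overlapping-gaps-coincide g₁ g₂ (start<end g₁) (start<end g₂)

  outsideB : Fin k → Fin n → Fin n → Fin n → Bool
  outsideB w p q i = does (σ i ≟ᶠ w) ∧ not (does (toℕ p <? toℕ i) ∧ does (toℕ i <? toℕ q))

  occOutside : Fin k → Fin n → Fin n → ℕ
  occOutside w p q = countB (outsideB w p q) (allFin n)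

  occ-split : ∀ w p q → occ σ w ≡ occBetween σ w p q + occOutside w p q
  occ-split w p q = countB-split _ _ (allFin n)

  disjoint-occBetween : ∀ w p₁ q₁ p₂ q₂ → toℕ q₁ ≤ toℕ p₂ →
    occBetween σ w p₁ q₁ + occBetween σ w p₂ q₂ ≤ occ σ w
  disjoint-occBetween w p₁ q₁ p₂ q₂ q₁≤p₂ = begin
    occBetween σ w p₁ q₁ + occBetween σ w p₂ q₂ ≤⟨ +-monoʳ-≤ _ (countB-mono later (allFin n)) ⟩
    occBetween σ w p₁ q₁ + occOutside w p₁ q₁   ≡⟨ occ-split w p₁ q₁ ⟨
    occ σ w                                     ∎
    where
      open ≤-Reasoning
      later : ∀ i → T (does (σ i ≟ᶠ w) ∧ does (toℕ p₂ <? toℕ i) ∧ does (toℕ i <? toℕ q₂)) →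
              T (outsideB w p₁ q₁ i)
      later i t with from-does ((σ i ≟ᶠ w) ×-dec (toℕ p₂ <? toℕ i) ×-dec (toℕ i <? toℕ q₂)) t
      ... | σi≡w , p₂<i , _ =
        to-does ((σ i ≟ᶠ w) ×-dec ¬? ((toℕ p₁ <? toℕ i) ×-dec (toℕ i <? toℕ q₁)))
          (σi≡w , λ (_ , i<q₁) → <-asym i<q₁ (≤-<-trans q₁≤p₂ p₂<i))

  record Concentrated (w : Fin k) (p q : Fin n) : Set where
    field
      occurs   : 0 < occ σ w
      majority : 9 * occ σ w ≤ 10 * occBetween σ w p q

  open Concentrated

  concentrated-not-disjoint : ∀ {w p₁ q₁ p₂ q₂} → Concentrated w p₁ q₁ → Concentrated w p₂ q₂ →
    toℕ q₁ ≤ toℕ p₂ → ⊥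
  concentrated-not-disjoint {w} {p₁} {q₁} {p₂} {q₂} c₁ c₂ q₁≤p₂ =
    disjoint-majorities {occ σ w} {occBetween σ w p₁ q₁} {occBetween σ w p₂ q₂}
      (occurs c₁) (majority c₁) (majority c₂) (disjoint-occBetween w p₁ q₁ p₂ q₂ q₁≤p₂)

  gaps-concentrating-one-symbol-coincide : ∀ {m w p₁ q₁ p₂ q₂} →
    IsGap m p₁ q₁ → IsGap m p₂ q₂ → Concentrated w p₁ q₁ → Concentrated w p₂ q₂ →
    (p₁ , q₁) ≡ (p₂ , q₂)
  gaps-concentrating-one-symbol-coincide {p₁ = p₁} {q₁} {p₂} {q₂} g₁ g₂ c₁ c₂
    with toℕ p₁ <? toℕ q₂ | toℕ p₂ <? toℕ q₁
  ... | yes p₁<q₂ | yes p₂<q₁ = overlapping-gaps-coincide g₁ g₂ p₁<q₂ p₂<q₁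
  ... | no p₁≮q₂  | _         = ⊥-elim (concentrated-not-disjoint c₂ c₁ (≮⇒≥ p₁≮q₂))
  ... | _         | no p₂≮q₁  = ⊥-elim (concentrated-not-disjoint c₁ c₂ (≮⇒≥ p₂≮q₁))

  -- witnessB is literally the test under any in isFullB, and fullGapB the one counted by
  -- fullGaps, so both unfold to the definitions in Defs.
  witnessB : Fin k → Fin n → Fin n → Fin k → Bool
  witnessB m p q w =
    not (does (w ≟ᶠ m)) ∧ does (1 ≤? occ σ w) ∧ does (9 * occ σ w ≤? 10 * occBetween σ w p q)

  witness⇒concentrated : ∀ m p q w → T (witnessB m p q w) → Concentrated w p q
  witness⇒concentrated m p q w t with from-does
    (¬? (w ≟ᶠ m) ×-dec (1 ≤? occ σ w) ×-dec (9 * occ σ w ≤? 10 * occBetween σ w p q)) t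
  ... | _ , 0<a , maj = record { occurs = 0<a ; majority = maj }

  fullGapB : Fin k → Fin n × Fin n → Bool
  fullGapB m (p , q) = isGapB σ m p q ∧ isFullB σ m p q

  record FullGap (m : Fin k) (p q : Fin n) : Set where
    field
      gap       : IsGap m p q
      witness   : Fin k
      witnessed : T (witnessB m p q witness)

  open FullGap

  fullGap⇒ : ∀ m p q → T (fullGapB m (p , q)) → FullGap m p q
  fullGap⇒ m p q t = record
    { gap = isGap⇒ m p q (proj₁ parts) ; witness = proj₁ witnessing ; witnessed = proj₂ witnessing }
    where
      parts : T (isGapB σ m p q) × T (isFullB σ m p q)
      parts = from-does (T? (isGapB σ m p q) ×-dec T? (isFullB σ m p q)) t
      witnessing : ∃ λ w → T (witnessB m p q w)
      witnessing = satisfied (any⁻ (witnessB m p q) (allFin k) (proj₂ parts))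

  witness-concentrated : ∀ {m p q} (f : FullGap m p q) → Concentrated (witness f) p q
  witness-concentrated {m} {p} {q} f = witness⇒concentrated m p q (witness f) (witnessed f)

  isBadB : Fin k → Bool
  isBadB m = isCommonB σ m ∧ not (does (10 * fullGaps σ m <? 9 * occ σ m))

  bad⇒ : ∀ m → T (isBadB m) → k < 10 * occ σ m × 9 * occ σ m ≤ 10 * fullGaps σ m
  bad⇒ m t with from-does ((k <? 10 * occ σ m) ×-dec ¬? (10 * fullGaps σ m <? 9 * occ σ m)) t
  ... | common , many-full = common , ≮⇒≥ many-full

  numBad numNotBad : ℕ
  numBad    = countB isBadB (allFin k)
  numNotBad = countB (λ m → not (isBadB m)) (allFin k)

  hasBadWitnessB : Fin k → Fin n × Fin n → Bool
  hasBadWitnessB m (p , q) = any (λ w → witnessB m p q w ∧ isBadB w) (allFin k)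

  fullGaps-without-bad-witness≤numNotBad : ∀ m →
    countB (λ g → fullGapB m g ∧ not (hasBadWitnessB m g)) (positionPairs n) ≤ numNotBad
  fullGaps-without-bad-witness≤numNotBad m =
    countB-injection (λ g t → witness (full g t)) injective (positionPairs-unique n) (allFin k) maps
    where
      unwitnessed⇒ : ∀ g → T (fullGapB m g ∧ not (hasBadWitnessB m g)) →
        T (fullGapB m g) × ¬ T (hasBadWitnessB m g)
      unwitnessed⇒ g = from-does (T? (fullGapB m g) ×-dec ¬? (T? (hasBadWitnessB m g)))
      full : ∀ g → T (fullGapB m g ∧ not (hasBadWitnessB m g)) → FullGap m (proj₁ g) (proj₂ g)
      full (p , q) t = fullGap⇒ m p q (proj₁ (unwitnessed⇒ (p , q) t))
      injective : ∀ g₁ g₂ t₁ t₂ → witness (full g₁ t₁) ≡ witness (full g₂ t₂) → g₁ ≡ g₂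
      injective g₁ g₂ t₁ t₂ same-witness =
        gaps-concentrating-one-symbol-coincide (gap (full g₁ t₁)) (gap (full g₂ t₂))
          (witness-concentrated (full g₁ t₁))
          (subst (λ w → Concentrated w (proj₁ g₂) (proj₂ g₂)) (sym same-witness)
            (witness-concentrated (full g₂ t₂)))
      maps : ∀ {g} → g ∈ positionPairs n → (t : T (fullGapB m g ∧ not (hasBadWitnessB m g))) →
        witness (full g t) ∈ allFin k × T (not (isBadB (witness (full g t))))
      maps {p , q} _ t = ∈-allFin w , to-does (¬? (T? (isBadB w))) λ bad →
        proj₂ (unwitnessed⇒ (p , q) t) (any⁺ _ (lose (∈-allFin w)
          (to-does (T? (witnessB m p q w) ×-dec T? (isBadB w)) (witnessed (full (p , q) t) , bad))))
        where
          w : Fin k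
          w = witness (full (p , q) t)

  insideB : ℕ → ℕ → Fin n × Fin n → Bool
  insideB lo hi (p , q) = does (lo ≤? toℕ p) ∧ does (toℕ q <? hi)

  outerEndpoint : Fin n → Fin n × Fin n → Fin n
  outerEndpoint p (p' , q') with toℕ p <? toℕ p'
  ... | yes _ = q'
  ... | no  _ = p'

  fullGaps-not-inside≤occOutside : ∀ w p q →
    countB (λ g → fullGapB w g ∧ not (insideB (suc (toℕ p)) (toℕ q) g)) (positionPairs n)
      ≤ occOutside w p q
  fullGaps-not-inside≤occOutside w p q =
    countB-injection (λ g _ → outerEndpoint p g) injective (positionPairs-unique n) (allFin n) maps
    where
      outside⇒ : ∀ g → T (fullGapB w g ∧ not (insideB (suc (toℕ p)) (toℕ q) g)) →
        IsGap w (proj₁ g) (proj₂ g) × ¬ (toℕ p < toℕ (proj₁ g) × toℕ (proj₂ g) < toℕ q)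
      outside⇒ (p' , q') t with from-does
        (T? (fullGapB w (p' , q')) ×-dec ¬? ((toℕ p <? toℕ p') ×-dec (toℕ q' <? toℕ q))) t
      ... | isFullGap , not-inside = gap (fullGap⇒ w p' q' isFullGap) , not-inside
      injective : ∀ g₁ g₂ t₁ t₂ → outerEndpoint p g₁ ≡ outerEndpoint p g₂ → g₁ ≡ g₂
      injective (p₁ , q₁) (p₂ , q₂) t₁ t₂ same
        with outside⇒ (p₁ , q₁) t₁ | outside⇒ (p₂ , q₂) t₂ | toℕ p <? toℕ p₁ | toℕ p <? toℕ p₂
      ... | g₁ , _ | g₂ , _ | yes _    | yes _    = gaps-with-same-end-coincide g₁ g₂ same
      ... | g₁ , _ | g₂ , _ | no _     | no _     = gaps-with-same-start-coincide g₁ g₂ same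
      ... | g₁ , _ | _      | yes p<p₁ | no p≮p₂  =
        ⊥-elim (p≮p₂ (<-≤-trans (<-trans p<p₁ (start<end g₁)) (≤-reflexive (cong toℕ same))))
      ... | _      | g₂ , _ | no p≮p₁  | yes p<p₂ =
        ⊥-elim (p≮p₁ (<-≤-trans (<-trans p<p₂ (start<end g₂)) (≤-reflexive (cong toℕ (sym same)))))
      maps : ∀ {g} → g ∈ positionPairs n →
        (t : T (fullGapB w g ∧ not (insideB (suc (toℕ p)) (toℕ q) g))) →
        outerEndpoint p g ∈ allFin n × T (outsideB w p q (outerEndpoint p g))
      maps {p' , q'} _ t with outside⇒ (p' , q') t | toℕ p <? toℕ p'
      ... | g , not-inside | yes p<p' = ∈-allFin q' ,
        to-does ((σ q' ≟ᶠ w) ×-dec ¬? ((toℕ p <? toℕ q') ×-dec (toℕ q' <? toℕ q)))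
          (end g , λ (_ , q'<q) → not-inside (p<p' , q'<q))
      ... | g , not-inside | no p≮p' = ∈-allFin p' ,
        to-does ((σ p' ≟ᶠ w) ×-dec ¬? ((toℕ p <? toℕ p') ×-dec (toℕ p' <? toℕ q)))
          (start g , λ (p<p' , _) → p≮p' p<p')

  fullGapsInside : Fin k → ℕ → ℕ → ℕ
  fullGapsInside m lo hi = countB (λ g → fullGapB m g ∧ insideB lo hi g) (positionPairs n)

  Heavy : Fin k → ℕ → ℕ → Set
  Heavy m lo hi = numNotBad < fullGapsInside m lo hi

  record BadWitnessedGap (m : Fin k) (lo hi : ℕ) : Set where
    field
      left right   : Fin n
      lo≤left      : lo ≤ toℕ left
      left<right   : toℕ left < toℕ right
      right<hi     : toℕ right < hi
      badWitness   : Fin k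
      concentrated : Concentrated badWitness left right
      bad          : T (isBadB badWitness)

  heavy⇒badWitnessedGap : ∀ m lo hi → Heavy m lo hi → BadWitnessedGap m lo hi
  heavy⇒badWitnessedGap m lo hi heavy =
    extract (countB-witness witnessedB (positionPairs n) some-witnessed)
    where
      insideFullB : Fin n × Fin n → Bool
      insideFullB g = fullGapB m g ∧ insideB lo hi g
      witnessedB : Fin n × Fin n → Bool
      witnessedB g = insideFullB g ∧ hasBadWitnessB m g
      drop-inside : ∀ g → T (insideFullB g ∧ not (hasBadWitnessB m g)) →
        T (fullGapB m g ∧ not (hasBadWitnessB m g))
      drop-inside g t with from-does
        ((T? (fullGapB m g) ×-dec T? (insideB lo hi g)) ×-dec ¬? (T? (hasBadWitnessB m g))) t
      ... | (full , _) , unwitnessed =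
        to-does (T? (fullGapB m g) ×-dec ¬? (T? (hasBadWitnessB m g))) (full , unwitnessed)
      some-witnessed : 0 < countB witnessedB (positionPairs n)
      some-witnessed = positive-summand
        (subst (numNotBad <_) (countB-split insideFullB (hasBadWitnessB m) (positionPairs n)) heavy)
        (≤-trans (countB-mono drop-inside (positionPairs n))
                 (fullGaps-without-bad-witness≤numNotBad m))
      extract : (∃ λ g → T (witnessedB g)) → BadWitnessedGap m lo hi
      extract ((p , q) , t)
        with from-does ((T? (fullGapB m (p , q)) ×-dec (lo ≤? toℕ p) ×-dec (toℕ q <? hi))
                         ×-dec T? (hasBadWitnessB m (p , q))) t
      ... | (full , lo≤p , q<hi) , hasBad
        with satisfied (any⁻ (λ w → witnessB m p q w ∧ isBadB w) (allFin k) hasBad)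
      ... | w , witnessed∧bad
        with from-does (T? (witnessB m p q w) ×-dec T? (isBadB w)) witnessed∧bad
      ... | witnessed , bad = record
        { left = p ; right = q ; lo≤left = lo≤p ; right<hi = q<hi
        ; left<right = start<end (gap (fullGap⇒ m p q full))
        ; badWitness = w ; concentrated = witness⇒concentrated m p q w witnessed ; bad = bad
        }

  nested-heavy : 100 * numNotBad < 4 * k → ∀ {w p q} → Concentrated w p q → T (isBadB w) →
    Heavy w (suc (toℕ p)) (toℕ q)
  nested-heavy few {w} {p} {q} c bad =
    nested-majority {occ σ w} {occBetween σ w p q} {occOutside w p q} {fullGaps σ w}
      {fullGapsInside w (suc (toℕ p)) (toℕ q)}
      (occ-split w p q) (majority c) (proj₂ (bad⇒ w bad)) fullGaps≤ (proj₁ (bad⇒ w bad)) few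
    where
      open ≤-Reasoning
      fullGaps≤ : fullGaps σ w ≤ fullGapsInside w (suc (toℕ p)) (toℕ q) + occOutside w p q
      fullGaps≤ = begin
        fullGaps σ w
          ≡⟨ countB-split (fullGapB w) (insideB (suc (toℕ p)) (toℕ q)) (positionPairs n) ⟩
        fullGapsInside w (suc (toℕ p)) (toℕ q)
          + countB (λ g → fullGapB w g ∧ not (insideB (suc (toℕ p)) (toℕ q) g)) (positionPairs n)
          ≤⟨ +-monoʳ-≤ _ (fullGaps-not-inside≤occOutside w p q) ⟩
        fullGapsInside w (suc (toℕ p)) (toℕ q) + occOutside w p q ∎

  whole-window-heavy : 100 * numNotBad < 4 * k → ∀ {m} → T (isBadB m) → Heavy m 0 n
  -- The whole sequence as the enclosing interval: all occurrences inside, none outside.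
  whole-window-heavy few {m} bad =
    nested-majority {occ σ m} {occ σ m} {0} {fullGaps σ m} {fullGapsInside m 0 n}
      (sym (+-identityʳ _)) (*-monoˡ-≤ (occ σ m) (n≤1+n 9)) (proj₂ (bad⇒ m bad))
      (≤-trans (countB-mono every-gap-inside (positionPairs n)) (m≤m+n _ 0)) (proj₁ (bad⇒ m bad)) few
    where
      every-gap-inside : ∀ g → T (fullGapB m g) → T (fullGapB m g ∧ insideB 0 n g)
      every-gap-inside (p , q) t =
        to-does (T? (fullGapB m (p , q)) ×-dec (0 ≤? toℕ p) ×-dec (toℕ q <? n)) (t , z≤n , toℕ<n q)

  no-heavy-window : 100 * numNotBad < 4 * k → ∀ s m lo hi → hi ≤ lo + s → ¬ Heavy m lo hi
  no-heavy-window few s m lo hi hi≤lo+s heavy = descend s hi≤lo+s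
    where
      open BadWitnessedGap (heavy⇒badWitnessedGap m lo hi heavy)
      open ≤-Reasoning
      descend : ∀ s → hi ≤ lo + s → ⊥
      descend zero    hi≤lo+0 = <-irrefl refl (begin-strict
        hi          ≤⟨ hi≤lo+0 ⟩
        lo + 0      ≡⟨ +-identityʳ lo ⟩
        lo          ≤⟨ lo≤left ⟩
        toℕ left    <⟨ left<right ⟩
        toℕ right   <⟨ right<hi ⟩
        hi          ∎)
      descend (suc s) hi≤lo+1+s = no-heavy-window few s badWitness (suc (toℕ left)) (toℕ right)
        (≤-trans (≤-pred (begin
          suc (toℕ right)    ≤⟨ right<hi ⟩
          hi                 ≤⟨ hi≤lo+1+s ⟩
          lo + suc s         ≤⟨ +-monoˡ-≤ (suc s) lo≤left ⟩
          toℕ left + suc s   ≡⟨ +-suc (toℕ left) s ⟩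
          suc (toℕ left + s) ∎)) (n≤1+n _))
        (nested-heavy few concentrated bad)

  numCommon≡numGood+numBad : numCommon σ ≡ numGood σ + numBad
  numCommon≡numGood+numBad =
    countB-split (isCommonB σ) (λ m → does (10 * fullGaps σ m <? 9 * occ σ m)) (allFin k)

  k≡numBad+numNotBad : k ≡ numBad + numNotBad
  k≡numBad+numNotBad = sym (trans (countB-complement isBadB (allFin k)) (length-tabulate (λ i → i)))

  many-good-symbols : 99 * k ≤ 100 * numCommon σ → 3 * k ≤ 100 * numGood σ
  many-good-symbols common = decidable-stable (3 * k ≤? 100 * numGood σ) few-good-impossible
    where
      few-good-impossible : ¬ ¬ 3 * k ≤ 100 * numGood σ
      few-good-impossible few-good =
        no-heavy-window few (suc n) m 0 n (n≤1+n n) (whole-window-heavy few bad)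
        where
          bad-majority : 96 * k < 100 * numBad
          bad-majority = bad-supermajority {k} {numCommon σ} {numGood σ} {numBad}
            numCommon≡numGood+numBad common (≰⇒> few-good)
          few : 100 * numNotBad < 4 * k
          few = few-not-bad {k} {numBad} {numNotBad} k≡numBad+numNotBad bad-majority
          some-bad : ∃ λ m → T (isBadB m)
          some-bad = countB-witness isBadB (allFin k)
            (*-cancelˡ-< 100 0 numBad (≤-<-trans z≤n bad-majority))
          m : Fin k
          m = proj₁ some-bad
          bad : T (isBadB m)
          bad = proj₂ some-bad

lemma5p2 : ∃ λ K → ∀ k → K ≤ k → ∀ n → (σ : Seq k n) →
    BelowBound n k →
    99 * k ≤ 100 * numCommon σ →
    3 * k ≤ 100 * numGood σ
lemma5p2 = 0 , λ k _ n σ _ → many-good-symbols σ
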